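{- Let $n\ge2$, let $\alpha=(a_1,\dots,a_n)\in PP_n$ be complete, and let $k\ge1$. For $h\in[n]$ let $j_h=\min\{j\in[n]: a_i\ne h\text{ for all } i>j\}$ and $j_h^*=\min\{j\in[n]: a_i<h\text{ for all } i>j\}$. Then the following are equivalent: (i) $\alpha\in PF_{n,k}$; (ii) for every $h\in[n]$ with $|\alpha|_h\ne0$ there exists an integer $\lambda_h$ with $0\le\lambda_h\le k-u_\alpha(h)$ such that $|\{i<j_h: a_i\in[h-u_\alpha(h)-\lambda_h,\,h-1]\}|\le\lambda_h$; (iii) for every $h\in[n]$ there exists an integer $\lambda_h$ with $0\le\lambda_h\le k-u_\alpha(h)$ such that $|\{i<j_h^*: a_i\in[h-u_\alpha(h)-\lambda_h,\,h-1]\}|=\lambda_h$.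
   Context: $[n]=\{1,\dots,n\}$, $PP_n=[n]^n$; $[a,b]$ denotes the integer interval $\{a,\dots,b\}$. Cars $c_1,\dots,c_n$ arrive in order at a one-way street with spots $1,\dots,n$; car $c_i$ has preference $a_i$. Under the $k$-Naples parking rule, car $c_i$ drives to spot $a_i$ and parks there if free; otherwise it checks spots $a_i-1,\dots,a_i-k$ (only those $\ge1$) in order and parks in the first free one; otherwise it drives forward to the first free spot $j>a_i$, failing if none. $PF_{n,k}$: preferences for which all cars park. $|\alpha|_i=|\{j:a_j=i\}|$, $u_\alpha(j)=\sum_{i=j}^n|\alpha|_i-(n-j+1)$, $U_\alpha=\{j:u_\alpha(j)\ge1\}$; $\alpha$ is complete if $U_\alpha=\{2,\dots,n\}$. -}

module Defs where

open import Data.Nat as ℕ using (ℕ; zero; suc; _+_; _∸_; _≤_; _<_)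
open import Data.Nat.Properties using () renaming (_≟_ to _≟ℕ_; _≤?_ to _≤?ℕ_; _<?_ to _<?ℕ_)
open import Data.Integer as ℤ using (ℤ; +_)
open import Data.Fin using (Fin; toℕ) renaming (zero to fz; suc to fs)
open import Data.Bool using (Bool; true; false; if_then_else_; not; _∧_; _∨_)
open import Data.List using (List; []; _∷_; tabulate; map; upTo)
open import Data.Nat.ListAction using (sum)
open import Data.Bool.ListAction using (any)
open import Data.Empty using (⊥)
open import Data.Maybe using (Maybe; just; nothing)
open import Data.Product using (Σ; _×_)
open import Relation.Nullary.Decidable using (⌊_⌋)
open import Relation.Binary.PropositionalEquality using (_≡_)
open import Function.Bundles using (_⇔_)

-- Preference lists.  A preference α = (a_1,…,a_n) is a function
-- Fin n → ℕ; paper index i corresponds to t : Fin n with i = toℕ t + 1.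

Pref : ℕ → Set
Pref n = Fin n → ℕ

idx : ∀ {n} → Fin n → ℕ
idx t = suc (toℕ t)

InPP : (n : ℕ) → Pref n → Set
InPP n α = (t : Fin n) → (1 ≤ α t) × (α t ≤ n)

countFin : ∀ {n} → (Fin n → Bool) → ℕ
countFin {zero}  p = 0
countFin {suc n} p = (if p fz then 1 else 0) + countFin (λ t → p (fs t))

allFin? : ∀ {n} → (Fin n → Bool) → Bool
allFin? {zero}  p = true
allFin? {suc n} p = p fz ∧ allFin? (λ t → p (fs t))

sumFT : ℕ → ℕ → (ℕ → ℕ) → ℕ
sumFT j m f = sum (map (λ t → f (j + t)) (upTo (suc m ∸ j)))

-- least j in [1,n] with p j (returns n if there is none; in our uses
-- p n always holds, so this is the minimum of a nonempty set)
leastIn : ℕ → (ℕ → Bool) → ℕ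
leastIn n p = go 1 n
  where
  go : ℕ → ℕ → ℕ
  go j zero    = n
  go j (suc f) = if p j then j else go (suc j) f

isFree : List ℕ → ℕ → Bool
isFree occ s = not (any (λ o → ⌊ o ≟ℕ s ⌋) occ)

backSearch : List ℕ → ℕ → ℕ → Maybe ℕ
backSearch occ zero     m       = nothing
backSearch occ (suc p)  zero    = nothing
backSearch occ (suc p)  (suc m) =
  if isFree occ (suc p) then just (suc p) else backSearch occ p m

fwdSearch : List ℕ → ℕ → ℕ → Maybe ℕ
fwdSearch occ j zero    = nothing
fwdSearch occ j (suc f) = if isFree occ j then just j else fwdSearch occ (suc j) f

parkOne : ℕ → ℕ → List ℕ → ℕ → Maybe ℕ
parkOne n k occ a with isFree occ a
... | true  = just a
... | false with backSearch occ (a ∸ 1) k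
...   | just s  = just s
...   | nothing = fwdSearch occ (suc a) (n ∸ a)

parkAll : ℕ → ℕ → List ℕ → List ℕ → Maybe (List ℕ)
parkAll n k occ []       = just occ
parkAll n k occ (a ∷ as) with parkOne n k occ a
... | nothing = nothing
... | just s  = parkAll n k (s ∷ occ) as

InPF : (n k : ℕ) → Pref n → Set
InPF n k α = Σ (List ℕ) λ occ → parkAll n k [] (tabulate α) ≡ just occ

mult : ∀ {n} → Pref n → ℕ → ℕ
mult α i = countFin (λ t → ⌊ α t ≟ℕ i ⌋)

u : (n : ℕ) → Pref n → ℕ → ℤ
u n α j = + sumFT j n (mult α) ℤ.- (+ (n ∸ j + 1))

-- α complete iff U_α = {j ∈ [n] : u_α(j) ≥ 1} equals {2,…,n}
Complete : (n : ℕ) → Pref n → Set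
Complete n α = (j : ℕ) → 1 ≤ j → j ≤ n → ((+ 1 ℤ.≤ u n α j) ⇔ (2 ≤ j))

_⇒ᵇ_ : Bool → Bool → Bool
x ⇒ᵇ y = not x ∨ y

jh : (n : ℕ) → Pref n → ℕ → ℕ
jh n α h = leastIn n (λ j → allFin? (λ t → ⌊ j <?ℕ idx t ⌋ ⇒ᵇ not ⌊ α t ≟ℕ h ⌋))

jh* : (n : ℕ) → Pref n → ℕ → ℕ
jh* n α h = leastIn n (λ j → allFin? (λ t → ⌊ j <?ℕ idx t ⌋ ⇒ᵇ ⌊ α t <?ℕ h ⌋))

countBelowIn : ∀ {n} → Pref n → ℕ → ℤ → ℤ → ℕ
countBelowIn α J lo hi =
  countFin (λ t → ⌊ idx t <?ℕ J ⌋ ∧ (⌊ lo ℤ.≤? + α t ⌋ ∧ ⌊ + α t ℤ.≤? hi ⌋))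

CondII : (n k : ℕ) → Pref n → Set
CondII n k α =
  (h : ℕ) → 1 ≤ h → h ≤ n → (mult α h ≡ 0 → ⊥) →
  Σ ℤ λ lam → (+ 0 ℤ.≤ lam) × (lam ℤ.≤ + k ℤ.- u n α h) ×
    (+ countBelowIn α (jh n α h) (+ h ℤ.- u n α h ℤ.- lam) (+ h ℤ.- + 1) ℤ.≤ lam)

CondIII : (n k : ℕ) → Pref n → Set
CondIII n k α =
  (h : ℕ) → 1 ≤ h → h ≤ n →
  Σ ℤ λ lam → (+ 0 ℤ.≤ lam) × (lam ℤ.≤ + k ℤ.- u n α h) ×
    (+ countBelowIn α (jh* n α h) (+ h ℤ.- u n α h ℤ.- lam) (+ h ℤ.- + 1) ≡ lam)

-- Run the cars one at a time, recording (preference, spot) for each parked car.  Two invariants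
-- carry the argument: a car that parked backwards left every spot between its spot and its
-- preference occupied, and a car that drove forwards left every spot from its preference − k up
-- to its spot occupied.  So if f is the largest spot still free when some car arrives, the cars
-- already parked that prefer a spot ≥ f number at most n − f, and those preferring a spot ≥ x,
-- for f < x ≤ f + k + 1, at least n + 1 − x.  Apply this to the last car tL preferring a spot
-- ≥ h: completeness fixes the number of cars preferring ≥ h at n − h + 1 + u_α(h), hence the
-- number of cars before tL preferring [f, h − 1] is h − f − u_α(h) ≤ k − u_α(h), the λ_h of (iii).
-- If instead some car fails, the same counts at the last car preferring a spot beyond f + k
-- contradict the bound of (ii).  Finally (iii) gives (ii) because j_h ≤ j_h^*.

module Submission where

open import Defs
open import Data.Nat using (ℕ; zero; suc; _+_; _∸_; _⊓_; _≤_; _<_; _≤?_; _<?_; z≤n; s≤s; s≤s⁻¹; s<s; s<s⁻¹)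
open import Data.Nat.Properties
open import Data.Nat.Tactic.RingSolver using (solve-∀)
open import Algebra.Properties.CommutativeSemigroup +-commutativeSemigroup using (interchange)
open import Data.Integer as ℤ using (ℤ; +_; +≤+)
import Data.Integer.Properties as ℤ
open import Data.Fin using (Fin; toℕ) renaming (zero to fz; suc to fs)
open import Data.Fin.Properties using (toℕ<n)
open import Data.Bool using (Bool; true; false; if_then_else_; not; _∧_)
open import Data.Bool.Properties using (∧-comm; ∧-assoc; ∧-zeroʳ; ∧-identityʳ; ∧-conicalˡ; ∧-conicalʳ; not-injective; ⇔→≡)
open import Data.List using (List; []; _∷_; _++_; [_]; map; tabulate; take; length; applyUpTo)
open import Data.Nat.ListAction using (sum)
open import Data.Nat.ListAction.Properties using (sum-++)
open import Data.Bool.ListAction using (any)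
open import Data.List.Properties using (length-map; length-take; length-tabulate; length-applyUpTo; applyUpTo-∷ʳ; map-upTo)
open import Data.List.Membership.Propositional using (_∈_; _∉_)
open import Data.List.Membership.DecPropositional _≟_ using (_∈?_)
open import Data.List.Membership.Propositional.Properties using (∈-map⁺; ∈-map⁻; ∈-applyUpTo⁺; ∈-applyUpTo⁻)
open import Data.List.Relation.Unary.Any using (here; there)
open import Data.List.Relation.Unary.All using (All; []; _∷_)
open import Data.List.Relation.Unary.All.Properties using (¬Any⇒All¬; take⁺; tabulate⁺)
open import Data.List.Relation.Unary.AllPairs using ([]; _∷_)
open import Data.List.Relation.Unary.Unique.Propositional using (Unique)
open import Data.List.Relation.Unary.Unique.Propositional.Properties using (applyUpTo⁺₁; Unique[x∷xs]⇒x∉xs)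
open import Data.Maybe as Maybe using (Maybe; just; nothing)
open import Data.Empty using (⊥; ⊥-elim)
open import Data.Sum using (_⊎_; inj₁; inj₂)
open import Data.Product using (Σ; _×_; _,_; proj₁; proj₂)
open import Function using (_∘_; case_of_)
open import Function.Bundles using (_⇔_; mk⇔; Equivalence)
open import Relation.Binary.Definitions using (tri<; tri≈; tri>)
open import Relation.Nullary using (Dec; yes; no; ¬_)
open import Relation.Nullary.Decidable using (⌊_⌋)
open import Relation.Binary.PropositionalEquality
  using (_≡_; _≢_; refl; sym; trans; cong; cong₂; subst; module ≡-Reasoning)

⌊⌋-true : ∀ {P : Set} (d : Dec P) → P → ⌊ d ⌋ ≡ true
⌊⌋-true (yes _) _ = refl
⌊⌋-true (no ¬p) p = ⊥-elim (¬p p)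

⌊⌋-false : ∀ {P : Set} (d : Dec P) → ¬ P → ⌊ d ⌋ ≡ false
⌊⌋-false (yes p) ¬p = ⊥-elim (¬p p)
⌊⌋-false (no _) _ = refl

⌊⌋-true⁻¹ : ∀ {P : Set} (d : Dec P) → ⌊ d ⌋ ≡ true → P
⌊⌋-true⁻¹ (yes p) _ = p

⌊⌋-false⁻¹ : ∀ {P : Set} (d : Dec P) → ⌊ d ⌋ ≡ false → ¬ P
⌊⌋-false⁻¹ (no ¬p) _ = ¬p

⌊⌋-cong : ∀ {P Q : Set} (d : Dec P) (e : Dec Q) → P ⇔ Q → ⌊ d ⌋ ≡ ⌊ e ⌋
⌊⌋-cong d e P⇔Q = ⇔→≡ (mk⇔ (⌊⌋-true e ∘ to ∘ ⌊⌋-true⁻¹ d) (⌊⌋-true d ∘ from ∘ ⌊⌋-true⁻¹ e))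
  where open Equivalence P⇔Q

∧-true⁻¹ : ∀ {a b} → a ∧ b ≡ true → a ≡ true × b ≡ true
∧-true⁻¹ {a} {b} e = ∧-conicalˡ a b e , ∧-conicalʳ a b e

∧-redundantʳ : ∀ {x y} → (x ≡ true → y ≡ true) → x ∧ y ≡ x
∧-redundantʳ {false} _ = refl
∧-redundantʳ {true} x⇒y = x⇒y refl

∧-redundantˡ : ∀ {x y} → (x ≡ true → y ≡ true) → y ∧ x ≡ x
∧-redundantˡ {x} {y} x⇒y = trans (∧-comm y x) (∧-redundantʳ x⇒y)

⇒ᵇ-true : ∀ {x y} → (x ≡ true → y ≡ true) → (x ⇒ᵇ y) ≡ true
⇒ᵇ-true {false} _ = refl
⇒ᵇ-true {true} x⇒y = x⇒y refl

⇒ᵇ-false : ∀ {x y} → x ≡ true → y ≡ false → (x ⇒ᵇ y) ≡ false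
⇒ᵇ-false refl refl = refl

suc-cases : ∀ {m n} → m ≤ suc n → m ≤ n ⊎ m ≡ suc n
suc-cases m≤1+n with m≤n⇒m<n∨m≡n m≤1+n
... | inj₁ m<1+n = inj₁ (s≤s⁻¹ m<1+n)
... | inj₂ m≡1+n = inj₂ m≡1+n

indicator : Bool → ℕ
indicator b = if b then 1 else 0

countFin-cong : ∀ {n} {p q : Fin n → Bool} → (∀ t → p t ≡ q t) → countFin p ≡ countFin q
countFin-cong {zero} _ = refl
countFin-cong {suc n} p≗q = cong₂ _+_ (cong indicator (p≗q fz)) (countFin-cong (p≗q ∘ fs))

countFin-mono : ∀ {n} {p q : Fin n → Bool} → (∀ t → p t ≡ true → q t ≡ true) → countFin p ≤ countFin q
countFin-mono {zero} _ = z≤n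
countFin-mono {suc n} {p} {q} p⇒q = +-mono-≤ (indicator-mono (p⇒q fz)) (countFin-mono (p⇒q ∘ fs))
  where
  indicator-mono : ∀ {a b} → (a ≡ true → b ≡ true) → indicator a ≤ indicator b
  indicator-mono {false} _ = z≤n
  indicator-mono {true} a⇒b rewrite a⇒b refl = ≤-refl

countFin-false : ∀ {n} {p : Fin n → Bool} → (∀ t → p t ≡ false) → countFin p ≡ 0
countFin-false {zero} _ = refl
countFin-false {suc n} {p} p≡false rewrite p≡false fz = countFin-false (p≡false ∘ fs)

countFin-true : ∀ {n} {p : Fin n → Bool} → (∀ t → p t ≡ true) → countFin p ≡ n
countFin-true {zero} _ = refl
countFin-true {suc n} {p} p≡true rewrite p≡true fz = cong suc (countFin-true (p≡true ∘ fs))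

countFin-pos : ∀ {n} {p : Fin n → Bool} (t : Fin n) → p t ≡ true → 1 ≤ countFin p
countFin-pos {p = p} fz pt rewrite pt = s≤s z≤n
countFin-pos {suc n} {p} (fs t) pt = ≤-trans (countFin-pos t pt) (m≤n+m _ (indicator (p fz)))

countFin-split : ∀ {n} (p b : Fin n → Bool) →
  countFin p ≡ countFin (λ t → p t ∧ b t) + countFin (λ t → p t ∧ not (b t))
countFin-split {zero} p b = refl
countFin-split {suc n} p b =
  trans (cong₂ _+_ (indicator-split (p fz) (b fz)) (countFin-split (p ∘ fs) (b ∘ fs)))
        (interchange (indicator (p fz ∧ b fz)) (indicator (p fz ∧ not (b fz)))
                     (countFin (λ t → p (fs t) ∧ b (fs t))) (countFin (λ t → p (fs t) ∧ not (b (fs t)))))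
  where
  indicator-split : ∀ x y → indicator x ≡ indicator (x ∧ y) + indicator (x ∧ not y)
  indicator-split false _ = refl
  indicator-split true false = refl
  indicator-split true true = refl

countFin-last : ∀ {n} (p : Fin n → Bool) (t₀ : Fin n) →
  countFin (λ t → ⌊ toℕ t ≟ toℕ t₀ ⌋ ∧ p t) ≡ indicator (p t₀)
countFin-last {suc n} p fz with p fz
... | true = cong suc (countFin-false {n} (λ _ → refl))
... | false = countFin-false {n} (λ _ → refl)
countFin-last {suc n} p (fs t₀) =
  trans (countFin-cong (λ t → cong (_∧ p (fs t)) (⌊⌋-cong (suc (toℕ t) ≟ suc (toℕ t₀)) (toℕ t ≟ toℕ t₀)
                                                   (mk⇔ suc-injective (cong suc)))))
        (countFin-last (p ∘ fs) t₀)

lastTrue : ∀ {n} (p : Fin n → Bool) →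
  (Σ (Fin n) λ t → p t ≡ true × (∀ s → toℕ t < toℕ s → p s ≡ false)) ⊎ (∀ t → p t ≡ false)
lastTrue {zero} p = inj₂ (λ ())
lastTrue {suc n} p with lastTrue (p ∘ fs)
... | inj₁ (t , pt , after) = inj₁ (fs t , pt , λ { fz () ; (fs s) t<s → after s (s≤s⁻¹ t<s) })
... | inj₂ none with p fz in p0
...   | true = inj₁ (fz , p0 , λ { fz () ; (fs s) _ → none s })
...   | false = inj₂ (λ { fz → p0 ; (fs s) → none s })

lastTrue-of-pos : ∀ {n} (p : Fin n → Bool) → ¬ countFin p ≡ 0 →
  Σ (Fin n) λ t → p t ≡ true × (∀ s → toℕ t < toℕ s → p s ≡ false)
lastTrue-of-pos p count≢0 with lastTrue p
... | inj₁ last = last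
... | inj₂ none = ⊥-elim (count≢0 (countFin-false none))

-- `leastIn` runs a loop local to its where-block.  Abstracting the loop's
-- arguments makes its unfolding a pattern unification problem, which names the loop.
mutual
  searchFrom : ℕ → (ℕ → Bool) → ℕ → ℕ → ℕ
  searchFrom = _

  private
    leastIn-unfold : ∀ m p → leastIn (suc m) p ≡ (if p 1 then 1 else searchFrom (suc m) p 2 m)
    leastIn-unfold m p with 2 | suc m
    ... | _ | _ = refl

searchFrom-≤ : ∀ N p j f L → p L ≡ true → j ≤ L → L < j + f → searchFrom N p j f ≤ L
searchFrom-≤ N p j zero L _ j≤L L<j = ⊥-elim (<⇒≱ L<j (subst (_≤ L) (sym (+-identityʳ j)) j≤L))
searchFrom-≤ N p j (suc f) L pL j≤L L<j+f with p j in pj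
... | true = j≤L
... | false with m≤n⇒m<n∨m≡n j≤L
...   | inj₁ j<L = searchFrom-≤ N p (suc j) f L pL j<L (subst (L <_) (+-suc j f) L<j+f)
...   | inj₂ refl = case trans (sym pj) pL of λ ()

searchFrom-≥ : ∀ N p j f L → (∀ i → j ≤ i → i < L → p i ≡ false) → L ≤ N → L ≤ searchFrom N p j f
searchFrom-≥ N p j zero L _ L≤N = L≤N
searchFrom-≥ N p j (suc f) L below L≤N with p j in pj
... | false = searchFrom-≥ N p (suc j) f L (λ i j<i → below i (<⇒≤ j<i)) L≤N
... | true with j <? L
...   | yes j<L = case trans (sym pj) (below j ≤-refl j<L) of λ ()
...   | no j≮L = ≮⇒≥ j≮L

leastIn-≤ : ∀ n p L → p L ≡ true → 1 ≤ L → L ≤ n → leastIn n p ≤ L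
leastIn-≤ n p L pL 1≤L L≤n = searchFrom-≤ n p 1 n L pL 1≤L (s≤s L≤n)

leastIn-≥ : ∀ n p L → (∀ i → 1 ≤ i → i < L → p i ≡ false) → L ≤ n → L ≤ leastIn n p
leastIn-≥ n p L = searchFrom-≥ n p 1 n L

allFin?-true : ∀ {n} {p : Fin n → Bool} → (∀ t → p t ≡ true) → allFin? p ≡ true
allFin?-true {zero} _ = refl
allFin?-true {suc n} {p} all rewrite all fz = allFin?-true (all ∘ fs)

allFin?-false : ∀ {n} {p : Fin n → Bool} (t : Fin n) → p t ≡ false → allFin? p ≡ false
allFin?-false {suc n} {p} fz pt rewrite pt = refl
allFin?-false {suc n} {p} (fs t) pt with p fz
... | true = allFin?-false t pt
... | false = refl

-- Pigeonhole on intervals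

module _ {A : Set} (_≟ᴬ_ : (x y : A) → Dec (x ≡ y)) where

  private
    remove : A → List A → List A
    remove x [] = []
    remove x (y ∷ ys) with x ≟ᴬ y
    ... | yes _ = ys
    ... | no _ = y ∷ remove x ys

    length-remove : ∀ {x} ys → x ∈ ys → suc (length (remove x ys)) ≡ length ys
    length-remove {x} (y ∷ ys) x∈ with x ≟ᴬ y
    ... | yes _ = refl
    length-remove {x} (y ∷ ys) (here x≡y) | no x≢y = ⊥-elim (x≢y x≡y)
    length-remove {x} (y ∷ ys) (there x∈) | no _ = cong suc (length-remove ys x∈)

    ∈-remove : ∀ {x z} ys → z ∈ ys → z ≢ x → z ∈ remove x ys
    ∈-remove {x} (y ∷ ys) z∈ z≢x with x ≟ᴬ y
    ∈-remove {x} (y ∷ ys) (here refl) z≢x | yes refl = ⊥-elim (z≢x refl)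
    ∈-remove {x} (y ∷ ys) (there z∈) z≢x | yes _ = z∈
    ∈-remove {x} (y ∷ ys) (here z≡y) z≢x | no _ = here z≡y
    ∈-remove {x} (y ∷ ys) (there z∈) z≢x | no _ = there (∈-remove ys z∈ z≢x)

  pigeonhole : ∀ xs ys → Unique xs → (∀ {z} → z ∈ xs → z ∈ ys) → length xs ≤ length ys
  pigeonhole [] ys _ _ = z≤n
  pigeonhole (x ∷ xs) ys unique@(_ ∷ unique-xs) xs⊆ys =
    subst (suc (length xs) ≤_) (length-remove ys (xs⊆ys (here refl)))
      (s≤s (pigeonhole xs (remove x ys) unique-xs
        (λ z∈xs → ∈-remove ys (xs⊆ys (there z∈xs)) (λ { refl → Unique[x∷xs]⇒x∉xs unique z∈xs }))))

interval : ℕ → ℕ → List ℕ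
interval lo c = applyUpTo (_+_ lo) c

∈-interval⁻ : ∀ {lo c y} → y ∈ interval lo c → lo ≤ y × y < lo + c
∈-interval⁻ {lo} y∈ with ∈-applyUpTo⁻ (_+_ lo) y∈
... | i , i<c , refl = m≤m+n lo i , +-monoʳ-< lo i<c

∈-interval⁺ : ∀ {lo c y} → lo ≤ y → y < lo + c → y ∈ interval lo c
∈-interval⁺ {lo} {c} {y} lo≤y y<lo+c =
  subst (_∈ interval lo c) (m+[n∸m]≡n lo≤y)
    (∈-applyUpTo⁺ (_+_ lo) (+-cancelˡ-< lo _ _ (subst (_< lo + c) (sym (m+[n∸m]≡n lo≤y)) y<lo+c)))

unique-interval : ∀ lo c → Unique (interval lo c)
unique-interval lo c = applyUpTo⁺₁ (_+_ lo) c (λ i<j _ → <⇒≢ (+-monoʳ-< lo i<j))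

length≤-of-bounded : ∀ xs lo c → Unique xs → (∀ {y} → y ∈ xs → lo ≤ y × y < lo + c) → length xs ≤ c
length≤-of-bounded xs lo c unique bounded =
  subst (length xs ≤_) (length-applyUpTo (_+_ lo) c)
    (pigeonhole _≟_ xs (interval lo c) unique (λ y∈ → ∈-interval⁺ (proj₁ (bounded y∈)) (proj₂ (bounded y∈))))

length≥-of-covering : ∀ xs lo c → (∀ y → lo ≤ y → y < lo + c → y ∈ xs) → c ≤ length xs
length≥-of-covering xs lo c covers =
  subst (_≤ length xs) (length-applyUpTo (_+_ lo) c)
    (pigeonhole _≟_ (interval lo c) xs (unique-interval lo c)
      (λ y∈ → covers _ (proj₁ (∈-interval⁻ y∈)) (proj₂ (∈-interval⁻ y∈))))

i-j+j≡i : ∀ i j → i ℤ.- j ℤ.+ j ≡ i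
i-j+j≡i i j = trans (ℤ.+-assoc i (ℤ.- j) j) (trans (cong (ℤ._+_ i) (ℤ.+-inverseˡ j)) (ℤ.+-identityʳ i))

i+j-j≡i : ∀ i j → i ℤ.+ j ℤ.- j ≡ i
i+j-j≡i i j = trans (ℤ.+-assoc i j (ℤ.- j)) (trans (cong (ℤ._+_ i) (ℤ.+-inverseʳ j)) (ℤ.+-identityʳ i))

i≤j-c⇔i+c≤j : ∀ i j c → (i ℤ.≤ j ℤ.- c) ⇔ (i ℤ.+ c ℤ.≤ j)
i≤j-c⇔i+c≤j i j c = mk⇔ (λ i≤j-c → subst (i ℤ.+ c ℤ.≤_) (i-j+j≡i j c) (ℤ.+-monoˡ-≤ c i≤j-c))
                    (λ i+c≤j → subst (ℤ._≤ j ℤ.- c) (i+j-j≡i i c) (ℤ.+-monoˡ-≤ (ℤ.- c) i+c≤j))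

+l≤+k-+u⇔l+u≤k : ∀ l k u → (+ l ℤ.≤ + k ℤ.- + u) ⇔ (l + u ≤ k)
+l≤+k-+u⇔l+u≤k l k u =
  mk⇔ (λ p → ℤ.drop‿+≤+ (subst (ℤ._≤ + k) (sym (ℤ.pos-+ l u)) (to p)))
      (λ q → from (subst (ℤ._≤ + k) (ℤ.pos-+ l u) (+≤+ q)))
  where open Equivalence (i≤j-c⇔i+c≤j (+ l) (+ k) (+ u))

i-c≤j⇔i≤j+c : ∀ i j c → (i ℤ.- c ℤ.≤ j) ⇔ (i ℤ.≤ j ℤ.+ c)
i-c≤j⇔i≤j+c i j c = mk⇔ (λ i-c≤j → subst (ℤ._≤ j ℤ.+ c) (i-j+j≡i i c) (ℤ.+-monoˡ-≤ c i-c≤j))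
                     (λ i≤j+c → subst (i ℤ.- c ℤ.≤_) (i+j-j≡i j c) (ℤ.+-monoˡ-≤ (ℤ.- c) i≤j+c))

+a≤+h-1⇔a<h : ∀ a h → (+ a ℤ.≤ + h ℤ.- + 1) ⇔ (a < h)
+a≤+h-1⇔a<h a h = mk⇔ (λ p → subst (_≤ h) (+-comm a 1) (to p)) (λ a<h → from (subst (_≤ h) (+-comm 1 a) a<h))
  where open Equivalence (+l≤+k-+u⇔l+u≤k a h 1)

+h-+u-+l≤+a⇔h≤a+[u+l] : ∀ h u l a → (+ h ℤ.- + u ℤ.- + l ℤ.≤ + a) ⇔ (h ≤ a + (u + l))
+h-+u-+l≤+a⇔h≤a+[u+l] h u l a =
  mk⇔ (λ p → ℤ.drop‿+≤+ (subst (+ h ℤ.≤_) (sym (ℤ.pos-+ a (u + l))) (to (subst (ℤ._≤ + a) h-u-l≡h-[u+l] p))))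
      (λ q → subst (ℤ._≤ + a) (sym h-u-l≡h-[u+l]) (from (subst (+ h ℤ.≤_) (ℤ.pos-+ a (u + l)) (+≤+ q))))
  where
  open Equivalence (i-c≤j⇔i≤j+c (+ h) (+ a) (+ (u + l)))
  h-u-l≡h-[u+l] : + h ℤ.- + u ℤ.- + l ≡ + h ℤ.- + (u + l)
  h-u-l≡h-[u+l] = begin
    + h ℤ.- + u ℤ.- + l          ≡⟨ ℤ.+-assoc (+ h) (ℤ.- + u) (ℤ.- + l) ⟩
    + h ℤ.+ (ℤ.- + u ℤ.- + l)    ≡⟨ cong (ℤ._+_ (+ h)) (sym (ℤ.neg-distrib-+ (+ u) (+ l))) ⟩
    + h ℤ.- (+ u ℤ.+ + l)        ≡⟨ cong (λ w → + h ℤ.- w) (sym (ℤ.pos-+ u l)) ⟩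
    + h ℤ.- + (u + l)            ∎
    where open ≡-Reasoning

window-lower : ∀ {n h x e l W} → h ≤ n → h ≡ x + (e + l) → suc n ∸ x ≤ (n ∸ h + e) + W → suc l ≤ W
window-lower {n} {h} {x} {e} {l} {W} h≤n h≡x+e+l bound =
  +-cancelˡ-≤ (n ∸ h + e) (suc l) W (subst (_≤ (n ∸ h + e) + W) 1+n-x≡ bound)
  where
  open ≡-Reasoning
  rearrange : ∀ a x e l → suc (a + (x + (e + l))) ≡ (a + e) + suc l + x
  rearrange = solve-∀
  1+n-x≡ : suc n ∸ x ≡ (n ∸ h + e) + suc l
  1+n-x≡ = begin
    suc n ∸ x                        ≡⟨ cong (λ m → suc m ∸ x) (sym (m∸n+n≡m h≤n)) ⟩
    suc (n ∸ h + h) ∸ x              ≡⟨ cong (λ h′ → suc (n ∸ h + h′) ∸ x) h≡x+e+l ⟩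
    suc (n ∸ h + (x + (e + l))) ∸ x  ≡⟨ cong (_∸ x) (rearrange (n ∸ h) x e l) ⟩
    (n ∸ h + e) + suc l + x ∸ x      ≡⟨ m+n∸n≡m _ x ⟩
    (n ∸ h + e) + suc l              ∎

window-width : ∀ {n h f e W} → f ≤ n → h ≤ n → (n ∸ h + e) + W ≡ n ∸ f → h ≡ f + (e + W)
window-width {n} {h} {f} {e} {W} f≤n h≤n sum≡n-f = +-cancelˡ-≡ (n ∸ h) h (f + (e + W)) (begin
  n ∸ h + h                ≡⟨ m∸n+n≡m h≤n ⟩
  n                        ≡⟨ sym (m∸n+n≡m f≤n) ⟩
  n ∸ f + f                ≡⟨ cong (_+ f) (sym sum≡n-f) ⟩
  (n ∸ h + e) + W + f      ≡⟨ rearrange (n ∸ h) e W f ⟩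
  n ∸ h + (f + (e + W))    ∎)
  where
  open ≡-Reasoning
  rearrange : ∀ a e W f → (a + e) + W + f ≡ a + (f + (e + W))
  rearrange = solve-∀

-- The parking process

any≟-true⁻¹ : ∀ occ s → any (λ o → ⌊ o ≟ s ⌋) occ ≡ true → s ∈ occ
any≟-true⁻¹ (o ∷ occ) s found with o ≟ s
... | yes refl = here refl
... | no _ = there (any≟-true⁻¹ occ s found)

any≟-false⁻¹ : ∀ occ s → any (λ o → ⌊ o ≟ s ⌋) occ ≡ false → s ∉ occ
any≟-false⁻¹ (o ∷ occ) s notFound s∈ with o ≟ s | s∈
... | yes _ | _ = case notFound of λ ()
... | no o≢s | here refl = o≢s refl
... | no _ | there s∈occ = any≟-false⁻¹ occ s notFound s∈occ

isFree-true⁻¹ : ∀ {occ s} → isFree occ s ≡ true → s ∉ occ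
isFree-true⁻¹ {occ} {s} _ with any (λ o → ⌊ o ≟ s ⌋) occ in found
... | false = any≟-false⁻¹ occ s found

isFree-false⁻¹ : ∀ {occ s} → isFree occ s ≡ false → s ∈ occ
isFree-false⁻¹ {occ} {s} _ with any (λ o → ⌊ o ≟ s ⌋) occ in found
... | true = any≟-true⁻¹ occ s found

backSearch-just : ∀ occ p m s → backSearch occ p m ≡ just s →
  s ∉ occ × 1 ≤ s × s ≤ p × p < s + m × (∀ y → s < y → y ≤ p → y ∈ occ)
backSearch-just occ (suc p) (suc m) s found with isFree occ (suc p) in free
backSearch-just occ (suc p) (suc m) s refl | true =
  isFree-true⁻¹ free , s≤s z≤n , ≤-refl , subst (suc p <_) (sym (+-suc (suc p) m)) (s≤s (m≤m+n (suc p) m)) ,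
  λ y s<y y≤s → ⊥-elim (<⇒≱ s<y y≤s)
... | false with backSearch-just occ p m s found
...   | s∉ , 1≤s , s≤p , p<s+m , between =
  s∉ , 1≤s , m≤n⇒m≤1+n s≤p , subst (suc p <_) (sym (+-suc s m)) (s≤s p<s+m) ,
  λ y s<y y≤1+p → case suc-cases y≤1+p of λ
    { (inj₁ y≤p) → between y s<y y≤p
    ; (inj₂ refl) → isFree-false⁻¹ free }

backSearch-nothing : ∀ occ p m → backSearch occ p m ≡ nothing →
  ∀ y → 1 ≤ y → y ≤ p → p < y + m → y ∈ occ
backSearch-nothing occ zero m _ y 1≤y y≤0 _ = ⊥-elim (<⇒≱ 1≤y y≤0)
backSearch-nothing occ (suc p) zero _ y _ y≤p p<y =
  ⊥-elim (<⇒≱ p<y (subst (_≤ suc p) (sym (+-identityʳ y)) y≤p))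
backSearch-nothing occ (suc p) (suc m) none y 1≤y y≤1+p 1+p<y+1+m with isFree occ (suc p) in free
... | false with suc-cases y≤1+p
...   | inj₁ y≤p = backSearch-nothing occ p m none y 1≤y y≤p (s<s⁻¹ (subst (suc p <_) (+-suc y m) 1+p<y+1+m))
...   | inj₂ refl = isFree-false⁻¹ free

fwdSearch-just : ∀ occ j f s → fwdSearch occ j f ≡ just s →
  s ∉ occ × j ≤ s × s < j + f × (∀ y → j ≤ y → y < s → y ∈ occ)
fwdSearch-just occ j (suc f) s found with isFree occ j in free
fwdSearch-just occ j (suc f) s refl | true =
  isFree-true⁻¹ free , ≤-refl , subst (j <_) (sym (+-suc j f)) (s≤s (m≤m+n j f)) , λ y j≤y y<j → ⊥-elim (<⇒≱ y<j j≤y)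
... | false with fwdSearch-just occ (suc j) f s found
...   | s∉ , j<s , s<1+j+f , between =
  s∉ , <⇒≤ j<s , subst (s <_) (sym (+-suc j f)) s<1+j+f ,
  λ y j≤y y<s → case m≤n⇒m<n∨m≡n j≤y of λ
    { (inj₁ j<y) → between y j<y y<s
    ; (inj₂ refl) → isFree-false⁻¹ free }

fwdSearch-nothing : ∀ occ j f → fwdSearch occ j f ≡ nothing → ∀ y → j ≤ y → y < j + f → y ∈ occ
fwdSearch-nothing occ j zero _ y j≤y y<j = ⊥-elim (<⇒≱ y<j (subst (_≤ y) (sym (+-identityʳ j)) j≤y))
fwdSearch-nothing occ j (suc f) none y j≤y y<j+1+f with isFree occ j in free
... | false with m≤n⇒m<n∨m≡n j≤y
...   | inj₁ j<y = fwdSearch-nothing occ (suc j) f none y j<y (subst (y <_) (+-suc j f) y<j+1+f)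
...   | inj₂ refl = isFree-false⁻¹ free

countList : ∀ {A : Set} → (A → Bool) → List A → ℕ
countList q [] = 0
countList q (x ∷ xs) = indicator (q x) + countList q xs

countFin-take : ∀ {A : Set} {n} (β : Fin n → A) (q : A → Bool) c →
  countFin (λ t → ⌊ toℕ t <? c ⌋ ∧ q (β t)) ≡ countList q (take c (tabulate β))
countFin-take {n = zero} β q zero = refl
countFin-take {n = zero} β q (suc c) = refl
countFin-take {n = suc n} β q zero = countFin-false (λ t → cong (_∧ q (β t)) (⌊⌋-false (toℕ t <? 0) (λ ())))
countFin-take {n = suc n} β q (suc c) rewrite ⌊⌋-true (0 <? suc c) (s≤s z≤n) =
  cong (_+_ (indicator (q (β fz))))
    (trans (countFin-cong (λ t → cong (_∧ q (β (fs t))) (⌊⌋-cong (suc (toℕ t) <? suc c) (toℕ t <? c) (mk⇔ s<s⁻¹ s<s))))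
           (countFin-take (β ∘ fs) q c))

record LargestFree (occ : List ℕ) (j f : ℕ) : Set where
  field
    1≤f        : 1 ≤ f
    f≤j        : f ≤ j
    free       : f ∉ occ
    full-above : ∀ y → f < y → y ≤ j → y ∈ occ

largestFree : ∀ occ j → Σ ℕ (LargestFree occ j) ⊎ (∀ y → 1 ≤ y → y ≤ j → y ∈ occ)
largestFree occ zero = inj₂ (λ y 1≤y y≤0 → ⊥-elim (<⇒≱ 1≤y y≤0))
largestFree occ (suc j) with suc j ∈? occ
... | no 1+j∉ = inj₁ (suc j , record
  { 1≤f = s≤s z≤n ; f≤j = ≤-refl ; free = 1+j∉ ; full-above = λ y 1+j<y y≤1+j → ⊥-elim (<⇒≱ 1+j<y y≤1+j) })
... | yes 1+j∈ with largestFree occ j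
...   | inj₁ (f , largest) = inj₁ (f , record
  { 1≤f = 1≤f ; f≤j = m≤n⇒m≤1+n f≤j ; free = free
  ; full-above = λ y f<y y≤1+j → case suc-cases y≤1+j of λ { (inj₁ y≤j) → full-above y f<y y≤j ; (inj₂ refl) → 1+j∈ } })
  where open LargestFree largest
...   | inj₂ full = inj₂ (λ y 1≤y y≤1+j → case suc-cases y≤1+j of λ
  { (inj₁ y≤j) → full y 1≤y y≤j ; (inj₂ refl) → 1+j∈ })

atLeast : ℕ → ℕ → Bool
atLeast x a = ⌊ x ≤? a ⌋

-- a ∈ [h − c, h − 1]
justBelow : ℕ → ℕ → ℕ → Bool
justBelow h c a = ⌊ a <? h ⌋ ∧ ⌊ h ≤? a + c ⌋

module Parking (n k : ℕ) where

  record Parks (occ : List ℕ) (a s : ℕ) : Set where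
    field
      free          : s ∉ occ
      spot≥1        : 1 ≤ s
      spot≤n        : s ≤ n
      pref≤spot+k   : a ≤ s + k
      backward-span : s < a → ∀ y → s < y → y ≤ a → y ∈ occ
      forward-span  : a < s → ∀ y → 1 ≤ y → a ≤ y + k → y < s → y ∈ occ

  parkOne-just : ∀ occ a s → 1 ≤ a → a ≤ n → parkOne n k occ a ≡ just s → Parks occ a s
  parkOne-just occ (suc a) s _ a≤n parked with isFree occ (suc a) in free
  parkOne-just occ (suc a) s _ a≤n refl | true = record
    { free = isFree-true⁻¹ free ; spot≥1 = s≤s z≤n ; spot≤n = a≤n ; pref≤spot+k = m≤m+n (suc a) k
    ; backward-span = λ s<s → ⊥-elim (<-irrefl refl s<s) ; forward-span = λ s<s → ⊥-elim (<-irrefl refl s<s) }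
  ... | false with backSearch occ a k in back
  parkOne-just occ (suc a) s _ a≤n refl | false | just s with backSearch-just occ a k s back
  ... | s∉ , 1≤s , s≤a , a<s+k , between = record
    { free = s∉ ; spot≥1 = 1≤s ; spot≤n = ≤-trans (m≤n⇒m≤1+n s≤a) a≤n ; pref≤spot+k = a<s+k
    ; backward-span = λ _ y s<y y≤1+a → case suc-cases y≤1+a of λ
        { (inj₁ y≤a) → between y s<y y≤a ; (inj₂ refl) → isFree-false⁻¹ free }
    ; forward-span = λ 1+a<s → ⊥-elim (<⇒≱ 1+a<s (m≤n⇒m≤1+n s≤a)) }
  parkOne-just occ (suc a) s _ a≤n fwd | false | nothing with fwdSearch-just occ (suc (suc a)) (n ∸ suc a) s fwd
  ... | s∉ , 1+a<s , s<2+a+[n∸1+a] , between = record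
    { free = s∉ ; spot≥1 = ≤-trans (s≤s z≤n) 1+a<s
    ; spot≤n = s≤s⁻¹ (subst (s <_) (cong suc (m+[n∸m]≡n a≤n)) s<2+a+[n∸1+a])
    ; pref≤spot+k = ≤-trans (<⇒≤ 1+a<s) (m≤m+n s k)
    ; backward-span = λ s<1+a → ⊥-elim (<⇒≱ s<1+a (<⇒≤ 1+a<s))
    ; forward-span = λ _ y 1≤y 1+a≤y+k y<s → case <-cmp y (suc a) of λ
        { (tri< y<1+a _ _) → backSearch-nothing occ a k back y 1≤y (s≤s⁻¹ y<1+a) 1+a≤y+k
        ; (tri≈ _ refl _) → isFree-false⁻¹ free
        ; (tri> _ _ 1+a<y) → between y 1+a<y y<s } }

  parkOne-nothing : ∀ occ a → 1 ≤ a → a ≤ n → parkOne n k occ a ≡ nothing →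
    ∀ y → 1 ≤ y → y ≤ n → a ≤ y + k → y ∈ occ
  parkOne-nothing occ (suc a) _ a≤n failed y 1≤y y≤n 1+a≤y+k with isFree occ (suc a) in free
  ... | false with backSearch occ a k in back
  ... | nothing with <-cmp y (suc a)
  ...   | tri< y<1+a _ _ = backSearch-nothing occ a k back y 1≤y (s≤s⁻¹ y<1+a) 1+a≤y+k
  ...   | tri≈ _ refl _ = isFree-false⁻¹ free
  ...   | tri> _ _ 1+a<y = fwdSearch-nothing occ (suc (suc a)) (n ∸ suc a) failed y 1+a<y
                             (subst (y <_) (sym (cong suc (m+[n∸m]≡n a≤n))) (s≤s y≤n))

  Trace : Set
  Trace = List (ℕ × ℕ)

  spots : Trace → List ℕ
  spots = map proj₂

  prefs : Trace → List ℕ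
  prefs = map proj₁

  run : Trace → List ℕ → Maybe Trace
  run R [] = just R
  run R (a ∷ as) with parkOne n k (spots R) a
  ... | nothing = nothing
  ... | just s = run ((a , s) ∷ R) as

  parkAll≡run : ∀ R as → parkAll n k (spots R) as ≡ Maybe.map spots (run R as)
  parkAll≡run R [] = refl
  parkAll≡run R (a ∷ as) with parkOne n k (spots R) a
  ... | nothing = refl
  ... | just s = parkAll≡run ((a , s) ∷ R) as

  run-just : ∀ as {occ} → parkAll n k [] as ≡ just occ → Σ Trace λ R → run [] as ≡ just R
  run-just as parked with run [] as in result
  ... | just R = R , refl
  ... | nothing = case trans (sym parked) (trans (parkAll≡run [] as) (cong (Maybe.map spots) result)) of λ ()

  run-∷ : ∀ R a {s} as → parkOne n k (spots R) a ≡ just s → run R (a ∷ as) ≡ run ((a , s) ∷ R) as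
  run-∷ R a as parked rewrite parked = refl

  run-prefix : ∀ {m} (β : Fin m → ℕ) R {R′} → run R (tabulate β) ≡ just R′ → (t : Fin m) →
    Σ Trace λ Rₜ → run R (take (toℕ t) (tabulate β)) ≡ just Rₜ × Σ ℕ λ s → parkOne n k (spots Rₜ) (β t) ≡ just s
  run-prefix {suc m} β R done t with parkOne n k (spots R) (β fz) in parked
  run-prefix {suc m} β R () t | nothing
  run-prefix {suc m} β R done fz | just s = R , refl , s , parked
  run-prefix {suc m} β R done (fs t) | just s with run-prefix (β ∘ fs) ((β fz , s) ∷ R) done t
  ... | Rₜ , upTo-t , s′ , parked-t = Rₜ , trans (run-∷ R (β fz) _ parked) upTo-t , s′ , parked-t

  run-failure : ∀ {m} (β : Fin m → ℕ) R → run R (tabulate β) ≡ nothing →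
    Σ (Fin m) λ t → Σ Trace λ Rₜ → run R (take (toℕ t) (tabulate β)) ≡ just Rₜ × parkOne n k (spots Rₜ) (β t) ≡ nothing
  run-failure {suc m} β R failed with parkOne n k (spots R) (β fz) in parked
  ... | nothing = fz , R , refl , parked
  ... | just s with run-failure (β ∘ fs) ((β fz , s) ∷ R) failed
  ...   | t , Rₜ , upTo-t , failed-t = fs t , Rₜ , trans (run-∷ R (β fz) _ parked) upTo-t , failed-t

  run-length : ∀ R as {R′} → run R as ≡ just R′ → length R′ ≡ length as + length R
  run-length R [] refl = refl
  run-length R (a ∷ as) done with parkOne n k (spots R) a
  ... | just s = trans (run-length ((a , s) ∷ R) as done) (+-suc (length as) (length R))

  run-prefs : ∀ R as {R′} → run R as ≡ just R′ → ∀ q → countList q (prefs R′) ≡ countList q as + countList q (prefs R)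
  run-prefs R [] refl q = refl
  run-prefs R (a ∷ as) done q with parkOne n k (spots R) a
  ... | just s = trans (run-prefs ((a , s) ∷ R) as done q)
                       (trans (sym (+-assoc (countList q as) (indicator (q a)) _))
                              (cong (_+ countList q (prefs R)) (+-comm (countList q as) (indicator (q a)))))

  record Invariant (R : Trace) : Set where
    field
      spot≤n        : ∀ {a s} → (a , s) ∈ R → s ≤ n
      unique-spots  : Unique (spots R)
      backward-span : ∀ {a s} → (a , s) ∈ R → s < a → ∀ y → s ≤ y → y ≤ a → y ∈ spots R
      forward-span  : ∀ {a s} → (a , s) ∈ R → a < s → ∀ y → 1 ≤ y → a ≤ y + k → y ≤ s → y ∈ spots R

  invariant-[] : Invariant []
  invariant-[] = record { spot≤n = λ () ; unique-spots = [] ; backward-span = λ () ; forward-span = λ () }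

  invariant-∷ : ∀ {R a s} → Invariant R → Parks (spots R) a s → Invariant ((a , s) ∷ R)
  invariant-∷ {R} {a} {s} inv parks = record
    { spot≤n = λ { (here refl) → spot≤n ; (there a,s∈) → I.spot≤n inv a,s∈ }
    ; unique-spots = ¬Any⇒All¬ (spots R) free ∷ I.unique-spots inv
    ; backward-span = backward
    ; forward-span = forward }
    where
    module I = Invariant
    open Parks parks
    backward : ∀ {a′ s′} → (a′ , s′) ∈ (a , s) ∷ R → s′ < a′ → ∀ y → s′ ≤ y → y ≤ a′ → y ∈ spots ((a , s) ∷ R)
    backward (here refl) s<a y s≤y y≤a with m≤n⇒m<n∨m≡n s≤y
    ... | inj₁ s<y = there (backward-span s<a y s<y y≤a)
    ... | inj₂ refl = here refl
    backward (there a,s∈) s<a y s≤y y≤a = there (I.backward-span inv a,s∈ s<a y s≤y y≤a)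
    forward : ∀ {a′ s′} → (a′ , s′) ∈ (a , s) ∷ R → a′ < s′ →
              ∀ y → 1 ≤ y → a′ ≤ y + k → y ≤ s′ → y ∈ spots ((a , s) ∷ R)
    forward (here refl) a<s y 1≤y a≤y+k y≤s with m≤n⇒m<n∨m≡n y≤s
    ... | inj₁ y<s = there (forward-span a<s y 1≤y a≤y+k y<s)
    ... | inj₂ refl = here refl
    forward (there a,s∈) a<s y 1≤y a≤y+k y≤s = there (I.forward-span inv a,s∈ a<s y 1≤y a≤y+k y≤s)

  InRange : ℕ → Set
  InRange a = 1 ≤ a × a ≤ n

  run-invariant : ∀ R as {R′} → run R as ≡ just R′ → All InRange as → Invariant R → Invariant R′
  run-invariant R [] refl [] inv = inv
  run-invariant R (a ∷ as) done ((1≤a , a≤n) ∷ in-range) inv with parkOne n k (spots R) a in parked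
  ... | just s = run-invariant ((a , s) ∷ R) as done in-range (invariant-∷ inv (parkOne-just (spots R) a s 1≤a a≤n parked))

  spotsWith : (ℕ → Bool) → Trace → List ℕ
  spotsWith q [] = []
  spotsWith q ((a , s) ∷ R) = if q a then s ∷ spotsWith q R else spotsWith q R

  length-spotsWith : ∀ q R → length (spotsWith q R) ≡ countList q (prefs R)
  length-spotsWith q [] = refl
  length-spotsWith q ((a , s) ∷ R) with q a
  ... | true = cong suc (length-spotsWith q R)
  ... | false = length-spotsWith q R

  ∈-spotsWith⁻ : ∀ q R {y} → y ∈ spotsWith q R → Σ ℕ λ a → (a , y) ∈ R × q a ≡ true
  ∈-spotsWith⁻ q ((a , s) ∷ R) y∈ with q a in qa | y∈
  ... | true | here refl = a , here refl , qa
  ... | true | there y∈′ with ∈-spotsWith⁻ q R y∈′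
  ...   | a′ , a′,y∈ , qa′ = a′ , there a′,y∈ , qa′
  ∈-spotsWith⁻ q ((a , s) ∷ R) _ | false | y∈′ with ∈-spotsWith⁻ q R y∈′
  ...   | a′ , a′,y∈ , qa′ = a′ , there a′,y∈ , qa′

  ∈-spotsWith⁺ : ∀ q R {a y} → (a , y) ∈ R → q a ≡ true → y ∈ spotsWith q R
  ∈-spotsWith⁺ q ((a , s) ∷ R) (here refl) qa rewrite qa = here refl
  ∈-spotsWith⁺ q ((a′ , s) ∷ R) (there a,y∈) qa with q a′
  ... | true = there (∈-spotsWith⁺ q R a,y∈ qa)
  ... | false = ∈-spotsWith⁺ q R a,y∈ qa

  unique-spotsWith : ∀ q R → Unique (spots R) → Unique (spotsWith q R)
  unique-spotsWith q [] _ = []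
  unique-spotsWith q ((a , s) ∷ R) (s∉ ∷ unique) with q a
  ... | true = All-spotsWith s∉ ∷ unique-spotsWith q R unique
    where
    All-spotsWith : ∀ {R′} → All (s ≢_) (spots R′) → All (s ≢_) (spotsWith q R′)
    All-spotsWith {[]} [] = []
    All-spotsWith {(a′ , s′) ∷ R′} (s≢s′ ∷ rest) with q a′
    ... | true = s≢s′ ∷ All-spotsWith rest
    ... | false = All-spotsWith rest
  ... | false = unique-spotsWith q R unique

  occupant : ∀ R {y} → y ∈ spots R → Σ ℕ λ a → (a , y) ∈ R
  occupant R y∈ with ∈-map⁻ proj₂ y∈
  ... | (a , s) , a,s∈ , refl = a , a,s∈

  -- A car preferring a spot ≥ f and parked at or below the free spot f would have passed f backwards.
  countAtLeast≤spotsAbove : ∀ R f → Invariant R → f ∉ spots R → f ≤ n → countList (atLeast f) (prefs R) ≤ n ∸ f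
  countAtLeast≤spotsAbove R f inv f∉ f≤n =
    subst (_≤ n ∸ f) (length-spotsWith (atLeast f) R)
      (length≤-of-bounded (spotsWith (atLeast f) R) (suc f) (n ∸ f) (unique-spotsWith (atLeast f) R unique-spots) above)
    where
    open Invariant inv
    above : ∀ {y} → y ∈ spotsWith (atLeast f) R → suc f ≤ y × y < suc f + (n ∸ f)
    above {y} y∈ with ∈-spotsWith⁻ (atLeast f) R y∈
    ... | a , a,y∈ , atLeast-f = f<y , subst (y <_) (sym (cong suc (m+[n∸m]≡n f≤n))) (s≤s (spot≤n a,y∈))
      where
      f≤a = ⌊⌋-true⁻¹ (f ≤? a) atLeast-f
      f<y : f < y
      f<y with <-cmp f y
      ... | tri< f<y _ _ = f<y
      ... | tri≈ _ refl _ = ⊥-elim (f∉ (∈-map⁺ proj₂ a,y∈))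
      ... | tri> _ _ y<f = ⊥-elim (f∉ (backward-span a,y∈ (<-≤-trans y<f f≤a) f (<⇒≤ y<f) f≤a))

  -- A car parked in [x, n] whose preference is below x ≤ f + k + 1 drove forward past the free spot f.
  countAtLeast≥spotsAbove : ∀ R f x → Invariant R → LargestFree (spots R) n f → f < x → x ≤ suc (f + k) → x ≤ suc n →
    suc n ∸ x ≤ countList (atLeast x) (prefs R)
  countAtLeast≥spotsAbove R f x inv largest f<x x≤1+f+k x≤1+n =
    subst (suc n ∸ x ≤_) (length-spotsWith (atLeast x) R)
      (length≥-of-covering (spotsWith (atLeast x) R) x (suc n ∸ x) covered)
    where
    open Invariant inv
    open LargestFree largest
    covered : ∀ y → x ≤ y → y < x + (suc n ∸ x) → y ∈ spotsWith (atLeast x) R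
    covered y x≤y y<1+n with occupant R (full-above y (<-≤-trans f<x x≤y) (s≤s⁻¹ (subst (y <_) (m+[n∸m]≡n x≤1+n) y<1+n)))
    ... | a , a,y∈ = ∈-spotsWith⁺ (atLeast x) R a,y∈ (⌊⌋-true (x ≤? a) x≤a)
      where
      x≤a : x ≤ a
      x≤a with x ≤? a
      ... | yes x≤a = x≤a
      ... | no x≰a = ⊥-elim (free (forward-span a,y∈ (<-≤-trans (≰⇒> x≰a) x≤y) f 1≤f
                                  (s≤s⁻¹ (≤-trans (≰⇒> x≰a) x≤1+f+k)) (≤-trans (<⇒≤ f<x) x≤y)))

-- Statistics of a preference list

module Preferences (n : ℕ) (α : Pref n) where

  countAtLeast : ℕ → ℕ
  countAtLeast x = countFin (λ t → atLeast x (α t))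

  countBelow : ℕ → (ℕ → Bool) → ℕ
  countBelow J q = countFin (λ t → ⌊ idx t <? J ⌋ ∧ q (α t))

  countBelow-monoˡ : ∀ {J J′} q → J ≤ J′ → countBelow J q ≤ countBelow J′ q
  countBelow-monoˡ {J} {J′} q J≤J′ = countFin-mono below
    where
    below : ∀ t → ⌊ idx t <? J ⌋ ∧ q (α t) ≡ true → ⌊ idx t <? J′ ⌋ ∧ q (α t) ≡ true
    below t t<J∧q with ∧-true⁻¹ t<J∧q
    ... | t<J , qt = cong₂ _∧_ (⌊⌋-true (idx t <? J′) (<-≤-trans (⌊⌋-true⁻¹ (idx t <? J) t<J) J≤J′)) qt

  countBelow-monoʳ : ∀ J {q q′} → (∀ a → q a ≡ true → q′ a ≡ true) → countBelow J q ≤ countBelow J q′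
  countBelow-monoʳ J {q} {q′} q⇒q′ = countFin-mono below
    where
    below : ∀ t → ⌊ idx t <? J ⌋ ∧ q (α t) ≡ true → ⌊ idx t <? J ⌋ ∧ q′ (α t) ≡ true
    below t t<J∧q with ∧-true⁻¹ t<J∧q
    ... | t<J , qt = cong₂ _∧_ t<J (q⇒q′ (α t) qt)

  countBelow≡countList : ∀ (t : Fin n) q → countBelow (idx t) q ≡ countList q (take (toℕ t) (tabulate α))
  countBelow≡countList t q =
    trans (countFin-cong (λ s → cong (_∧ q (α s)) (⌊⌋-cong (idx s <? idx t) (toℕ s <? toℕ t) (mk⇔ s<s⁻¹ s<s))))
          (countFin-take α q (toℕ t))

  countBelow-split : ∀ J x h c → h ≡ x + c →
    countBelow J (atLeast x) ≡ countBelow J (atLeast h) + countBelow J (justBelow h c)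
  countBelow-split J x h c h≡x+c =
    trans (countFin-split (λ t → ⌊ idx t <? J ⌋ ∧ atLeast x (α t)) (λ t → atLeast h (α t)))
          (cong₂ _+_ (countFin-cong (λ t → trans (∧-assoc ⌊ idx t <? J ⌋ (atLeast x (α t)) (atLeast h (α t)))
                                                (cong (⌊ idx t <? J ⌋ ∧_) (∧-redundantˡ (x≤ (α t))))))
                     (countFin-cong (λ t → trans (∧-assoc ⌊ idx t <? J ⌋ (atLeast x (α t)) (not (atLeast h (α t))))
                                                (cong (⌊ idx t <? J ⌋ ∧_) (window (α t))))))
    where
    x≤ : ∀ a → atLeast h a ≡ true → atLeast x a ≡ true
    x≤ a h≤a = ⌊⌋-true (x ≤? a) (≤-trans (subst (x ≤_) (sym h≡x+c) (m≤m+n x c)) (⌊⌋-true⁻¹ (h ≤? a) h≤a))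
    window : ∀ a → atLeast x a ∧ not (atLeast h a) ≡ justBelow h c a
    window a = ⇔→≡ (mk⇔
      (λ inside → let (x≤a , a≱h) = ∧-true⁻¹ inside
                      a<h = ≰⇒> (⌊⌋-false⁻¹ (h ≤? a) (not-injective a≱h)) in
        cong₂ _∧_ (⌊⌋-true (a <? h) a<h)
                  (⌊⌋-true (h ≤? a + c) (subst (_≤ a + c) (sym h≡x+c) (+-monoˡ-≤ c (⌊⌋-true⁻¹ (x ≤? a) x≤a)))))
      (λ inside → let (a<h , h≤a+c) = ∧-true⁻¹ inside in
        cong₂ _∧_ (⌊⌋-true (x ≤? a) (+-cancelʳ-≤ c x a (subst (_≤ a + c) h≡x+c (⌊⌋-true⁻¹ (h ≤? a + c) h≤a+c))))
                  (cong not (⌊⌋-false (h ≤? a) (<⇒≱ (⌊⌋-true⁻¹ (a <? h) a<h))))))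

  countAtLeast-last : ∀ tL x → (∀ s → toℕ tL < toℕ s → α s < x) →
    countAtLeast x ≡ countBelow (idx tL) (atLeast x) + indicator (atLeast x (α tL))
  countAtLeast-last tL x after =
    trans (countFin-split (λ t → atLeast x (α t)) (λ t → ⌊ idx t <? idx tL ⌋))
          (cong₂ _+_ (countFin-cong (λ t → ∧-comm (atLeast x (α t)) _))
                     (trans (countFin-cong atTL) (countFin-last (λ t → atLeast x (α t)) tL)))
    where
    atTL : ∀ t → atLeast x (α t) ∧ not ⌊ idx t <? idx tL ⌋ ≡ ⌊ toℕ t ≟ toℕ tL ⌋ ∧ atLeast x (α t)
    atTL t with <-cmp (toℕ t) (toℕ tL)
    ... | tri< t<tL _ _ rewrite ⌊⌋-true (idx t <? idx tL) (s<s t<tL) | ⌊⌋-false (toℕ t ≟ toℕ tL) (<⇒≢ t<tL) =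
      ∧-zeroʳ (atLeast x (α t))
    ... | tri≈ _ t≡tL _ rewrite ⌊⌋-false (idx t <? idx tL) (<-irrefl (cong suc t≡tL)) | ⌊⌋-true (toℕ t ≟ toℕ tL) t≡tL =
      ∧-identityʳ (atLeast x (α t))
    ... | tri> _ _ tL<t rewrite ⌊⌋-false (x ≤? α t) (<⇒≱ (after t tL<t)) = sym (∧-zeroʳ _)

  countAtLeast≤countBelow+1 : ∀ tL x → (∀ s → toℕ tL < toℕ s → α s < x) →
    countAtLeast x ≤ countBelow (idx tL) (atLeast x) + 1
  countAtLeast≤countBelow+1 tL x after =
    ≤-trans (≤-reflexive (countAtLeast-last tL x after)) (+-monoʳ-≤ _ (indicator≤1 (atLeast x (α tL))))
    where
    indicator≤1 : ∀ b → indicator b ≤ 1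
    indicator≤1 true = ≤-refl
    indicator≤1 false = z≤n

  countAtLeast≡countBelow+1 : ∀ tL x → x ≤ α tL → (∀ s → toℕ tL < toℕ s → α s < x) →
    countAtLeast x ≡ countBelow (idx tL) (atLeast x) + 1
  countAtLeast≡countBelow+1 tL x x≤αtL after =
    trans (countAtLeast-last tL x after)
          (cong (λ b → countBelow (idx tL) (atLeast x) + indicator b) (⌊⌋-true (x ≤? α tL) x≤αtL))

  lastAtLeast : ∀ h → ¬ countAtLeast h ≡ 0 → Σ (Fin n) λ tL → h ≤ α tL × (∀ s → toℕ tL < toℕ s → α s < h)
  lastAtLeast h nonzero with lastTrue-of-pos (λ t → atLeast h (α t)) nonzero
  ... | tL , h≤αtL , after =
    tL , ⌊⌋-true⁻¹ (h ≤? α tL) h≤αtL , λ s tL<s → ≰⇒> (⌊⌋-false⁻¹ (h ≤? α s) (after s tL<s))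

  lastAtLeast-after : ∀ h t → h ≤ α t →
    Σ (Fin n) λ tL → h ≤ α tL × toℕ t ≤ toℕ tL × (∀ s → toℕ tL < toℕ s → α s < h)
  lastAtLeast-after h t h≤αt with lastAtLeast h (λ none → <⇒≱ (countFin-pos t (⌊⌋-true (h ≤? α t) h≤αt)) (≤-reflexive none))
  ... | tL , h≤αtL , after = tL , h≤αtL , ≮⇒≥ (λ tL<t → <⇒≱ (after t tL<t) h≤αt) , after

  occurs : ∀ t → ¬ mult α (α t) ≡ 0
  occurs t none = <⇒≱ (countFin-pos t (⌊⌋-true (α t ≟ α t) refl)) (≤-reflexive none)

  jh≤idx : ∀ h tE → (∀ s → toℕ tE < toℕ s → α s ≢ h) → jh n α h ≤ idx tE
  jh≤idx h tE after = leastIn-≤ n _ (idx tE)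
    (allFin?-true (λ s → ⇒ᵇ-true (λ tE<s →
      cong not (⌊⌋-false (α s ≟ h) (after s (s<s⁻¹ (⌊⌋-true⁻¹ (idx tE <? idx s) tE<s)))))))
    (s≤s z≤n) (toℕ<n tE)

  idx≤jh : ∀ h tE → α tE ≡ h → idx tE ≤ jh n α h
  idx≤jh h tE αtE≡h = leastIn-≥ n _ (idx tE)
    (λ i _ i<tE → allFin?-false tE (⇒ᵇ-false (⌊⌋-true (i <? idx tE) i<tE) (cong not (⌊⌋-true (α tE ≟ h) αtE≡h))))
    (toℕ<n tE)

  jh*≤idx : ∀ h tE → (∀ s → toℕ tE < toℕ s → α s < h) → jh* n α h ≤ idx tE
  jh*≤idx h tE after = leastIn-≤ n _ (idx tE)
    (allFin?-true (λ s → ⇒ᵇ-true (λ tE<s → ⌊⌋-true (α s <? h) (after s (s<s⁻¹ (⌊⌋-true⁻¹ (idx tE <? idx s) tE<s))))))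
    (s≤s z≤n) (toℕ<n tE)

  idx≤jh* : ∀ h tE → h ≤ α tE → idx tE ≤ jh* n α h
  idx≤jh* h tE h≤αtE = leastIn-≥ n _ (idx tE)
    (λ i _ i<tE → allFin?-false tE (⇒ᵇ-false (⌊⌋-true (i <? idx tE) i<tE) (⌊⌋-false (α tE <? h) (≤⇒≯ h≤αtE))))
    (toℕ<n tE)

  jh≤jh* : ∀ h → ¬ mult α h ≡ 0 → jh n α h ≤ jh* n α h
  jh≤jh* h occurs with lastTrue-of-pos (λ t → ⌊ α t ≟ h ⌋) occurs
  ... | tE , αtE≡h , after =
    ≤-trans (jh≤idx h tE (λ s tE<s → ⌊⌋-false⁻¹ (α s ≟ h) (after s tE<s)))
            (idx≤jh* h tE (≤-reflexive (sym (⌊⌋-true⁻¹ (α tE ≟ h) αtE≡h))))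

  countBelowIn≡countBelow : ∀ J h u l →
    countBelowIn α J (+ h ℤ.- + u ℤ.- + l) (+ h ℤ.- + 1) ≡ countBelow J (justBelow h (u + l))
  countBelowIn≡countBelow J h u l = countFin-cong (λ t → cong (⌊ idx t <? J ⌋ ∧_)
    (trans (cong₂ _∧_ (⌊⌋-cong (_ ℤ.≤? + α t) (h ≤? α t + (u + l)) (+h-+u-+l≤+a⇔h≤a+[u+l] h u l (α t)))
                      (⌊⌋-cong (+ α t ℤ.≤? _) (α t <? h) (+a≤+h-1⇔a<h (α t) h)))
           (∧-comm ⌊ h ≤? α t + (u + l) ⌋ ⌊ α t <? h ⌋)))

  sum-mult≡countBetween : ∀ j c → sum (applyUpTo (λ i → mult α (j + i)) c) ≡ countFin (λ t → ⌊ j ≤? α t ⌋ ∧ ⌊ α t <? j + c ⌋)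
  sum-mult≡countBetween j zero = sym (countFin-false empty)
    where
    empty : ∀ t → ⌊ j ≤? α t ⌋ ∧ ⌊ α t <? j + 0 ⌋ ≡ false
    empty t with j ≤? α t
    ... | yes j≤a = ⌊⌋-false (α t <? j + 0) (λ a<j → <⇒≱ (subst (α t <_) (+-identityʳ j) a<j) j≤a)
    ... | no _ = refl
  sum-mult≡countBetween j (suc c) = begin
    sum (applyUpTo f (suc c))                        ≡⟨ cong sum (sym (applyUpTo-∷ʳ f c)) ⟩
    sum (applyUpTo f c ++ [ f c ])                   ≡⟨ sum-++ (applyUpTo f c) [ f c ] ⟩
    sum (applyUpTo f c) + (f c + 0)                  ≡⟨ cong₂ _+_ (sum-mult≡countBetween j c) (+-identityʳ (f c)) ⟩
    countFin (between (j + c)) + mult α (j + c)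
      ≡⟨ cong₂ _+_ (countFin-cong (λ t → sym (shorter t))) (countFin-cong (λ t → sym (last t))) ⟩
    countFin (λ t → between (j + suc c) t ∧ ⌊ α t <? j + c ⌋) + countFin (λ t → between (j + suc c) t ∧ not ⌊ α t <? j + c ⌋)
                                                     ≡⟨ sym (countFin-split (between (j + suc c)) (λ t → ⌊ α t <? j + c ⌋)) ⟩
    countFin (between (j + suc c))                   ∎
    where
    open ≡-Reasoning
    f : ℕ → ℕ
    f i = mult α (j + i)
    between : ℕ → Fin n → Bool
    between hi t = ⌊ j ≤? α t ⌋ ∧ ⌊ α t <? hi ⌋
    j+c<j+1+c : j + c < j + suc c
    j+c<j+1+c = +-monoʳ-< j ≤-refl
    shorter : ∀ t → between (j + suc c) t ∧ ⌊ α t <? j + c ⌋ ≡ between (j + c) t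
    shorter t = trans (∧-assoc ⌊ j ≤? α t ⌋ ⌊ α t <? j + suc c ⌋ ⌊ α t <? j + c ⌋)
      (cong (⌊ j ≤? α t ⌋ ∧_) (∧-redundantˡ (λ a<j+c →
        ⌊⌋-true (α t <? j + suc c) (<-trans (⌊⌋-true⁻¹ (α t <? j + c) a<j+c) j+c<j+1+c))))
    last : ∀ t → between (j + suc c) t ∧ not ⌊ α t <? j + c ⌋ ≡ ⌊ α t ≟ j + c ⌋
    last t = ⇔→≡ (mk⇔
      (λ inside → let (j≤a∧a<j+1+c , a≮j+c) = ∧-true⁻¹ inside in
        ⌊⌋-true (α t ≟ j + c)
          (≤-antisym (s≤s⁻¹ (subst (α t <_) (+-suc j c) (⌊⌋-true⁻¹ (α t <? j + suc c) (proj₂ (∧-true⁻¹ j≤a∧a<j+1+c)))))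
                     (≮⇒≥ (⌊⌋-false⁻¹ (α t <? j + c) (not-injective a≮j+c)))))
      (λ a≡j+c → let a≡ = ⌊⌋-true⁻¹ (α t ≟ j + c) a≡j+c in
        cong₂ _∧_ (cong₂ _∧_ (⌊⌋-true (j ≤? α t) (subst (j ≤_) (sym a≡) (m≤m+n j c)))
                             (⌊⌋-true (α t <? j + suc c) (subst (_< j + suc c) (sym a≡) j+c<j+1+c)))
                  (cong not (⌊⌋-false (α t <? j + c) (λ a<j+c → <-irrefl a≡ a<j+c)))))

  sumFT≡countAtLeast : (∀ t → α t ≤ n) → ∀ j → j ≤ suc n → sumFT j n (mult α) ≡ countAtLeast j
  sumFT≡countAtLeast α≤n j j≤1+n = begin
    sumFT j n (mult α)                                            ≡⟨ cong sum (map-upTo f (suc n ∸ j)) ⟩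
    sum (applyUpTo f (suc n ∸ j))                                 ≡⟨ sum-mult≡countBetween j (suc n ∸ j) ⟩
    countFin (λ t → ⌊ j ≤? α t ⌋ ∧ ⌊ α t <? j + (suc n ∸ j) ⌋)  ≡⟨ countFin-cong (λ t → ∧-redundantʳ (λ _ → belowEnd t)) ⟩
    countAtLeast j                                                ∎
    where
    open ≡-Reasoning
    f : ℕ → ℕ
    f i = mult α (j + i)
    belowEnd : ∀ t → ⌊ α t <? j + (suc n ∸ j) ⌋ ≡ true
    belowEnd t = ⌊⌋-true (α t <? j + (suc n ∸ j)) (subst (α t <_) (sym (m+[n∸m]≡n j≤1+n)) (s≤s (α≤n t)))

  countAtLeast-1 : (∀ t → 1 ≤ α t) → countAtLeast 1 ≡ n
  countAtLeast-1 1≤α = countFin-true (λ t → ⌊⌋-true (1 ≤? α t) (1≤α t))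

module MainArgument (n k : ℕ) (α : Pref n) (inPP : InPP n α) (complete : Complete n α) where

  open Parking n k
  open Preferences n α

  1≤α : ∀ t → 1 ≤ α t
  1≤α t = proj₁ (inPP t)

  α≤n : ∀ t → α t ≤ n
  α≤n t = proj₂ (inPP t)

  slots : ℕ → ℕ
  slots h = n ∸ h + 1

  u≡countAtLeast-slots : ∀ h → h ≤ n → u n α h ≡ + countAtLeast h ℤ.- + slots h
  u≡countAtLeast-slots h h≤n = cong (λ N → + N ℤ.- + slots h) (sumFT≡countAtLeast α≤n h (m≤n⇒m≤1+n h≤n))

  slots<countAtLeast : ∀ h → 2 ≤ h → h ≤ n → slots h < countAtLeast h
  slots<countAtLeast h 2≤h h≤n =
    Equivalence.to (+l≤+k-+u⇔l+u≤k 1 (countAtLeast h) (slots h))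
      (subst (+ 1 ℤ.≤_) (u≡countAtLeast-slots h h≤n) (Equivalence.from (complete h (≤-trans (s≤s z≤n) 2≤h) h≤n) 2≤h))

  slots≤countAtLeast : ∀ h → 1 ≤ h → h ≤ n → slots h ≤ countAtLeast h
  slots≤countAtLeast (suc zero) _ 1≤n =
    ≤-reflexive (trans (+-comm (n ∸ 1) 1) (trans (m+[n∸m]≡n 1≤n) (sym (countAtLeast-1 1≤α))))
  slots≤countAtLeast (suc (suc h)) _ h≤n = <⇒≤ (slots<countAtLeast (suc (suc h)) (s≤s (s≤s z≤n)) h≤n)

  excess : ℕ → ℕ
  excess h = countAtLeast h ∸ slots h

  countAtLeast≡slots+excess : ∀ h → 1 ≤ h → h ≤ n → countAtLeast h ≡ slots h + excess h
  countAtLeast≡slots+excess h 1≤h h≤n = sym (m+[n∸m]≡n (slots≤countAtLeast h 1≤h h≤n))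

  u≡excess : ∀ h → 1 ≤ h → h ≤ n → u n α h ≡ + excess h
  u≡excess h 1≤h h≤n =
    trans (u≡countAtLeast-slots h h≤n)
          (trans (ℤ.[+m]-[+n]≡m⊖n (countAtLeast h) (slots h)) (ℤ.⊖-≥ (slots≤countAtLeast h 1≤h h≤n)))

  bound⇔ : ∀ h l → 1 ≤ h → h ≤ n → (+ l ℤ.≤ + k ℤ.- u n α h) ⇔ (l + excess h ≤ k)
  bound⇔ h l 1≤h h≤n rewrite u≡excess h 1≤h h≤n = +l≤+k-+u⇔l+u≤k l k (excess h)

  countBelowIn≡countBelow-excess : ∀ J h l → 1 ≤ h → h ≤ n →
    countBelowIn α J (+ h ℤ.- u n α h ℤ.- + l) (+ h ℤ.- + 1) ≡ countBelow J (justBelow h (excess h + l))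
  countBelowIn≡countBelow-excess J h l 1≤h h≤n rewrite u≡excess h 1≤h h≤n = countBelowIn≡countBelow J h (excess h) l

  countBelow≡n∸h+excess : ∀ h tL → 1 ≤ h → h ≤ α tL → (∀ s → toℕ tL < toℕ s → α s < h) →
    countBelow (idx tL) (atLeast h) ≡ n ∸ h + excess h
  countBelow≡n∸h+excess h tL 1≤h h≤αtL after = +-cancelʳ-≡ 1 _ _ (begin
    countBelow (idx tL) (atLeast h) + 1  ≡⟨ sym (countAtLeast≡countBelow+1 tL h h≤αtL after) ⟩
    countAtLeast h                        ≡⟨ countAtLeast≡slots+excess h 1≤h (≤-trans h≤αtL (α≤n tL)) ⟩
    n ∸ h + 1 + excess h                  ≡⟨ +-assoc (n ∸ h) 1 (excess h) ⟩
    n ∸ h + (1 + excess h)                ≡⟨ cong (_+_ (n ∸ h)) (+-comm 1 (excess h)) ⟩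
    n ∸ h + (excess h + 1)                ≡⟨ sym (+-assoc (n ∸ h) (excess h) 1) ⟩
    n ∸ h + excess h + 1                  ∎)
    where open ≡-Reasoning

  record Prefix (t : Fin n) (R : Trace) : Set where
    field
      invariant : Invariant R
      counts    : ∀ q → countList q (prefs R) ≡ countBelow (idx t) q
      size      : length R ≡ toℕ t

  prefix : ∀ t {R} → run [] (take (toℕ t) (tabulate α)) ≡ just R → Prefix t R
  prefix t done = record
    { invariant = run-invariant [] (take (toℕ t) (tabulate α)) done (take⁺ (toℕ t) (tabulate⁺ inPP)) invariant-[]
    ; counts = λ q → trans (run-prefs [] (take (toℕ t) (tabulate α)) done q)
                           (trans (+-identityʳ _) (sym (countBelow≡countList t q)))
    ; size = trans (run-length [] (take (toℕ t) (tabulate α)) done)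
        (trans (+-identityʳ _) (trans (length-take (toℕ t) (tabulate α))
          (trans (cong (toℕ t ⊓_) (length-tabulate α)) (m≤n⇒m⊓n≡m (<⇒≤ (toℕ<n t)))))) }

  someSpotFree : ∀ {t R} → Prefix t R → ¬ (∀ y → 1 ≤ y → y ≤ n → y ∈ spots R)
  someSpotFree {t} {R} pre full =
    <⇒≱ (subst (_< n) (sym (trans (length-map proj₂ R) (Prefix.size pre))) (toℕ<n t))
        (length≥-of-covering (spots R) 1 n (λ y 1≤y y<1+n → full y 1≤y (s≤s⁻¹ y<1+n)))

  countBelow-atLeast≡n∸f : ∀ {t R f} → Prefix t R → LargestFree (spots R) n f → countBelow (idx t) (atLeast f) ≡ n ∸ f
  countBelow-atLeast≡n∸f {t} {R} {f} pre largest = ≤-antisym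
    (subst (_≤ n ∸ f) (counts (atLeast f)) (countAtLeast≤spotsAbove R f invariant free f≤j))
    (≤-trans (subst (n ∸ f ≤_) (counts (atLeast (suc f)))
                    (countAtLeast≥spotsAbove R f (suc f) invariant largest ≤-refl (s≤s (m≤m+n f k)) (s≤s f≤j)))
             (countBelow-monoʳ (idx t) (λ a f<a → ⌊⌋-true (f ≤? a) (<⇒≤ (⌊⌋-true⁻¹ (suc f ≤? a) f<a)))))
    where
    open Prefix pre
    open LargestFree largest

  countBelow-atLeast-lower : ∀ {t R f} tL → Prefix t R → LargestFree (spots R) n f → toℕ t ≤ toℕ tL →
    (∀ s → toℕ tL < toℕ s → α s < suc (f + k)) → ∀ x → f < x → x ≤ n → suc n ∸ x ≤ countBelow (idx tL) (atLeast x)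
  countBelow-atLeast-lower {t} {R} {f} tL pre largest t≤tL after x f<x x≤n with x ≤? suc (f + k)
  ... | yes x≤1+f+k =
    ≤-trans (subst (suc n ∸ x ≤_) (counts (atLeast x))
                   (countAtLeast≥spotsAbove R f x invariant largest f<x x≤1+f+k (m≤n⇒m≤1+n x≤n)))
            (countBelow-monoˡ (atLeast x) (s≤s t≤tL))
    where open Prefix pre
  ... | no x≰1+f+k = +-cancelʳ-≤ 1 (suc n ∸ x) _
    (subst (_≤ countBelow (idx tL) (atLeast x) + 1) (cong (_+ 1) (sym (+-∸-assoc 1 x≤n)))
      (≤-trans (slots<countAtLeast x (≤-trans (s≤s (LargestFree.1≤f largest)) f<x) x≤n)
               (countAtLeast≤countBelow+1 tL x (λ s tL<s → <-trans (after s tL<s) (≰⇒> x≰1+f+k)))))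

  III⇒II : CondIII n k α → CondII n k α
  III⇒II cond h 1≤h h≤n occurs with cond h 1≤h h≤n
  ... | lam , 0≤lam , lam≤k-u , count≡lam = lam , 0≤lam , lam≤k-u ,
    subst (λ c → + countBelowIn α (jh n α h) (+ h ℤ.- u n α h ℤ.- lam) (+ h ℤ.- + 1) ℤ.≤ c) count≡lam
      (+≤+ (countBelow-monoˡ (λ a → ⌊ + h ℤ.- u n α h ℤ.- lam ℤ.≤? + a ⌋ ∧ ⌊ + a ℤ.≤? + h ℤ.- + 1 ⌋) (jh≤jh* h occurs)))

  CondIIAt : ℕ → Set
  CondIIAt h = Σ ℕ λ l → l + excess h ≤ k × countBelow (jh n α h) (justBelow h (excess h + l)) ≤ l

  condII-at : CondII n k α → ∀ h → 1 ≤ h → h ≤ n → ¬ mult α h ≡ 0 → CondIIAt h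
  condII-at cond h 1≤h h≤n occurs with cond h 1≤h h≤n occurs
  ... | + l , _ , l≤k-u , count≤l =
    l , Equivalence.to (bound⇔ h l 1≤h h≤n) l≤k-u ,
    ℤ.drop‿+≤+ (subst (ℤ._≤ + l) (cong +_ (countBelowIn≡countBelow-excess (jh n α h) h l 1≤h h≤n)) count≤l)

  -- With x = h − u_α(h) − λ, the cars before tL preferring [x, h − 1] are at most λ by (ii),
  -- but counting the cars preferring a spot ≥ x forces more than λ of them.
  lastCar-contradiction : ∀ {t R f} tL → Prefix t R → LargestFree (spots R) n f → toℕ t ≤ toℕ tL →
    suc (f + k) ≤ α tL → (∀ s → toℕ tL < toℕ s → α s < suc (f + k)) → CondIIAt (α tL) → ⊥
  lastCar-contradiction {f = f} tL pre largest t≤tL f+k<h after (l , l+e≤k , count≤l) =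
    <⇒≱ (window-lower {x = x} {e} {l} h≤n h≡x+c (subst (suc n ∸ x ≤_) split lower)) W≤l
    where
    open LargestFree largest
    h = α tL
    h≤n = α≤n tL
    e = excess h
    c = e + l
    c≤h : c ≤ h
    c≤h = ≤-trans (subst (_≤ k) (+-comm l e) l+e≤k) (≤-trans (m≤n+m k f) (<⇒≤ f+k<h))
    x = h ∸ c
    h≡x+c : h ≡ x + c
    h≡x+c = sym (m∸n+n≡m c≤h)
    f<x : f < x
    f<x = +-cancelʳ-≤ c (suc f) x (subst (suc f + c ≤_) h≡x+c
            (≤-trans (s≤s (+-monoʳ-≤ f (subst (_≤ k) (+-comm l e) l+e≤k))) f+k<h))
    lower : suc n ∸ x ≤ countBelow (idx tL) (atLeast x)
    lower = countBelow-atLeast-lower tL pre largest t≤tL after x f<x (≤-trans (m∸n≤m h c) h≤n)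
    split : countBelow (idx tL) (atLeast x) ≡ n ∸ h + e + countBelow (idx tL) (justBelow h c)
    split = trans (countBelow-split (idx tL) x h c h≡x+c)
      (cong (_+ countBelow (idx tL) (justBelow h c))
            (countBelow≡n∸h+excess h tL (1≤α tL) ≤-refl (λ s tL<s → <-≤-trans (after s tL<s) f+k<h)))
    W≤l : countBelow (idx tL) (justBelow h c) ≤ l
    W≤l = ≤-trans (countBelow-monoˡ (justBelow h c) (idx≤jh h tL refl)) count≤l

  failedCar-beyond : ∀ {t R f} → LargestFree (spots R) n f → parkOne n k (spots R) (α t) ≡ nothing → suc (f + k) ≤ α t
  failedCar-beyond {t} {R} {f} largest failed with α t ≤? f + k
  ... | yes αt≤f+k = ⊥-elim (free (parkOne-nothing (spots R) (α t) (1≤α t) (α≤n t) failed f 1≤f f≤j αt≤f+k))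
    where open LargestFree largest
  ... | no αt≰f+k = ≰⇒> αt≰f+k

  carParks : CondII n k α → ∀ {t R} → Prefix t R → ¬ parkOne n k (spots R) (α t) ≡ nothing
  carParks cond {t} {R} pre failed with largestFree (spots R) n
  ... | inj₂ full = someSpotFree pre full
  ... | inj₁ (f , largest) with lastAtLeast-after (suc (f + k)) t (failedCar-beyond largest failed)
  ...   | tL , f+k<αtL , t≤tL , after =
    lastCar-contradiction tL pre largest t≤tL f+k<αtL after (condII-at cond (α tL) (1≤α tL) (α≤n tL) (occurs tL))

  CondIIIAt : ℕ → Set
  CondIIIAt h = Σ ℕ λ l → l + excess h ≤ k × countBelow (jh* n α h) (justBelow h (excess h + l)) ≡ l

  condIII-of : ∀ h → 1 ≤ h → h ≤ n → CondIIIAt h →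
    Σ ℤ λ lam → (+ 0 ℤ.≤ lam) × (lam ℤ.≤ + k ℤ.- u n α h) ×
      (+ countBelowIn α (jh* n α h) (+ h ℤ.- u n α h ℤ.- lam) (+ h ℤ.- + 1) ≡ lam)
  condIII-of h 1≤h h≤n (l , l+e≤k , count≡l) =
    + l , +≤+ z≤n , Equivalence.from (bound⇔ h l 1≤h h≤n) l+e≤k ,
    cong +_ (trans (countBelowIn≡countBelow-excess (jh* n α h) h l 1≤h h≤n) count≡l)

  condIII-1 : 1 ≤ n → CondIIIAt 1
  condIII-1 1≤n = 0 , ≤-trans (≤-reflexive excess-1≡0) z≤n , countFin-false nothingBelow1
    where
    excess-1≡0 : excess 1 ≡ 0
    excess-1≡0 = trans (cong₂ _∸_ (countAtLeast-1 1≤α) (trans (+-comm (n ∸ 1) 1) (m+[n∸m]≡n 1≤n))) (n∸n≡0 n)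
    nothingBelow1 : ∀ t → ⌊ idx t <? jh* n α 1 ⌋ ∧ justBelow 1 (excess 1 + 0) (α t) ≡ false
    nothingBelow1 t rewrite ⌊⌋-false (α t <? 1) (≤⇒≯ (1≤α t)) = ∧-zeroʳ _

  -- The cars before tL preferring a spot in [f, h − 1] are the λ of condition (iii).
  condIII-from-largestFree : ∀ {R f s} h tL → 2 ≤ h → h ≤ α tL → (∀ s′ → toℕ tL < toℕ s′ → α s′ < h) →
    Prefix tL R → Parks (spots R) (α tL) s → LargestFree (spots R) n f → CondIIIAt h
  condIII-from-largestFree {R} {f} {s} h tL 2≤h h≤αtL after pre parks largest = W , W+e≤k , count≡W
    where
    open LargestFree largest
    h≤n = ≤-trans h≤αtL (α≤n tL)
    e = excess h
    s≤f : s ≤ f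
    s≤f = ≮⇒≥ (λ f<s → Parks.free parks (full-above s f<s (Parks.spot≤n parks)))
    f<h : f < h
    f<h with h ≤? f
    ... | no h≰f = ≰⇒> h≰f
    ... | yes h≤f = ⊥-elim (<-irrefl refl (≤-trans (slots<countAtLeast f (≤-trans 2≤h h≤f) f≤j)
            (≤-trans (countAtLeast≤countBelow+1 tL f (λ s′ tL<s′ → <-≤-trans (after s′ tL<s′) h≤f))
                     (≤-reflexive (cong (_+ 1) (countBelow-atLeast≡n∸f pre largest))))))
    W = countBelow (idx tL) (justBelow h (h ∸ f))
    h≡f+e+W : h ≡ f + (e + W)
    h≡f+e+W = window-width f≤j h≤n (trans (sym split) (countBelow-atLeast≡n∸f pre largest))
      where
      split : countBelow (idx tL) (atLeast f) ≡ n ∸ h + e + W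
      split = trans (countBelow-split (idx tL) f h (h ∸ f) (sym (m+[n∸m]≡n (<⇒≤ f<h))))
                    (cong (_+ W) (countBelow≡n∸h+excess h tL (≤-trans (s≤s z≤n) 2≤h) h≤αtL after))
    W+e≤k : W + e ≤ k
    W+e≤k = subst (_≤ k) (+-comm e W) (+-cancelˡ-≤ f (e + W) k
      (subst (_≤ f + k) h≡f+e+W (≤-trans h≤αtL (≤-trans (Parks.pref≤spot+k parks) (+-monoˡ-≤ k s≤f)))))
    count≡W : countBelow (jh* n α h) (justBelow h (e + W)) ≡ W
    count≡W = cong₂ countBelow (≤-antisym (jh*≤idx h tL after) (idx≤jh* h tL h≤αtL))
                               (cong (justBelow h) (sym (trans (cong (_∸ f) h≡f+e+W) (m+n∸m≡n f (e + W)))))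

  countAtLeast≢0 : ∀ h → 1 ≤ h → h ≤ n → ¬ countAtLeast h ≡ 0
  countAtLeast≢0 h 1≤h h≤n none =
    <⇒≱ (≤-trans (s≤s z≤n) (≤-trans (≤-reflexive (+-comm 1 (n ∸ h))) (slots≤countAtLeast h 1≤h h≤n))) (≤-reflexive none)

  condIII-at : ∀ {R} → run [] (tabulate α) ≡ just R → ∀ h → 2 ≤ h → h ≤ n → CondIIIAt h
  condIII-at done h 2≤h h≤n with lastAtLeast h (countAtLeast≢0 h (≤-trans (s≤s z≤n) 2≤h) h≤n)
  ... | tL , h≤αtL , after with run-prefix α [] done tL
  ...   | R , upTo-tL , s , parked with largestFree (spots R) n | parkOne-just (spots R) (α tL) s (1≤α tL) (α≤n tL) parked
  ...     | inj₂ full | parks = ⊥-elim (Parks.free parks (full s (Parks.spot≥1 parks) (Parks.spot≤n parks)))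
  ...     | inj₁ (f , largest) | parks = condIII-from-largestFree h tL 2≤h h≤αtL after (prefix tL upTo-tL) parks largest

  I⇒III : InPF n k α → CondIII n k α
  I⇒III _ (suc zero) 1≤h 1≤n = condIII-of 1 1≤h 1≤n (condIII-1 1≤n)
  I⇒III (_ , parked) h@(suc (suc _)) 1≤h h≤n with run-just (tabulate α) parked
  ... | _ , done = condIII-of h 1≤h h≤n (condIII-at done h (s≤s (s≤s z≤n)) h≤n)

  II⇒I : CondII n k α → InPF n k α
  II⇒I cond with run [] (tabulate α) in result
  ... | just R = spots R , trans (parkAll≡run [] (tabulate α)) (cong (Maybe.map spots) result)
  ... | nothing with run-failure α [] result
  ...   | t , R , upTo-t , failed = ⊥-elim (carParks cond (prefix t upTo-t) failed)

  equivalences : (InPF n k α ⇔ CondII n k α) × (InPF n k α ⇔ CondIII n k α)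
  equivalences = mk⇔ (III⇒II ∘ I⇒III) II⇒I , mk⇔ I⇒III (II⇒I ∘ III⇒II)

mainTheorem4 : (n k : ℕ) → 2 ≤ n → 1 ≤ k → (α : Pref n) → InPP n α → Complete n α →
    (InPF n k α ⇔ CondII n k α) × (InPF n k α ⇔ CondIII n k α)
mainTheorem4 n k _ _ α inPP complete = MainArgument.equivalences n k α inPP complete
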